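{- Let $\mathcal{A} = \langle Q, \Sigma, \rightarrow, Q_0, \varphi\rangle$ be an automaton, let $T$ be a trap set of $\mathcal{A}$, and let $\rho$ be a run of $\mathcal{A}$ such that $\rho_i\in T$ for some $i\ge 0$. Then: (i) $\rho\models \mathrm{Inf}(S)$ for every $S\subseteq Q$ with $S\supseteq T$; (ii) if $T$ is a minimal trap set, then $\rho\models\mathrm{Inf}(S)$ for every non-empty $S\subseteq Q$ such that $S\cap T\neq\emptyset$ and $T\setminus S$ is a transient of $\mathcal{A}$.
   Context: An automaton is a tuple $\mathcal{A} = \langle Q, \Sigma, \rightarrow, Q_0, \varphi\rangle$ where $Q$ is a finite set of states, $\Sigma$ a finite alphabet, $\rightarrow \subseteq Q\times\Sigma\times Q$ a labelled transition relation, $Q_0\subseteq Q$ a non-empty set of initial states, and $\varphi$ an acceptance condition. We write $q \xrightarrow{a} q'$ iff $(q,a,q')\in\rightarrow$, and $q\rightarrow q'$ iff $q\xrightarrow{a}q'$ for some $a$. A run of $\mathcal{A}$ for a word $w=w_0w_1\dots\in\Sigma^\omega$ is an infinite sequence of states $\rho=\rho_0\rho_1\dots$ with $\rho_0\in Q_0$ and $\rho_i\xrightarrow{w_i}\rho_{i+1}$ for all $i$. For a non-empty $S\subseteq Q$: $\rho\models\mathrm{Fin}(S)$ iff there is $i$ such that $\rho_j\notin S$ for all $j>i$ ($S$ is visited only finitely often); $\rho\models\mathrm{Inf}(S)$ iff $\rho\not\models\mathrm{Fin}(S)$. A non-empty set $T\subseteq Q$ is a trap set if for every $q\in T$, $q\rightarrow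 q'$ implies $q'\in T$; it is minimal if no proper subset of it is a trap set. A set $S\subseteq Q$ is a transient of $\mathcal{A}$ if every run of $\mathcal{A}$ models $\mathrm{Inf}(Q\setminus S)$. -}

module Defs where

open import Data.Nat using (ℕ; _>_)
open import Data.Fin using (Fin)
open import Data.Fin.Subset using (Subset; _∈_; _∉_; _⊆_; _⊂_; ∁; Nonempty)
open import Data.Product using (Σ; ∃; _×_)
open import Relation.Nullary using (¬_)

data Cond (n : ℕ) : Set where
  tt ff   : Cond n
  Fin′    : Subset n → Cond n
  Inf′    : Subset n → Cond n
  _∧′_    : Cond n → Cond n → Cond n
  _∨′_    : Cond n → Cond n → Cond n

record Automaton (n m : ℕ) : Set₁ where
  field
    _⟶[_]_   : Fin n → Fin m → Fin n → Set
    Q₀       : Subset n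
    Q₀-ne    : Nonempty Q₀
    φ        : Cond n

module _ {n m : ℕ} (𝒜 : Automaton n m) where
  open Automaton 𝒜

  _⟶_ : Fin n → Fin n → Set
  q ⟶ q′ = ∃ λ a → q ⟶[ a ] q′

  IsRunOn : (ℕ → Fin m) → (ℕ → Fin n) → Set
  IsRunOn w ρ = (ρ 0 ∈ Q₀) × (∀ i → ρ i ⟶[ w i ] ρ (ℕ.suc i))

  IsRun : (ℕ → Fin n) → Set
  IsRun ρ = ∃ λ w → IsRunOn w ρ

  IsTrap : Subset n → Set
  IsTrap T = Nonempty T × (∀ q q′ → q ∈ T → q ⟶ q′ → q′ ∈ T)

  IsMinimalTrap : Subset n → Set
  IsMinimalTrap T = IsTrap T × (∀ T′ → T′ ⊂ T → ¬ IsTrap T′)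

_⊨Fin_ : ∀ {n} → (ℕ → Fin n) → Subset n → Set
ρ ⊨Fin S = ∃ λ i → ∀ j → j > i → ρ j ∉ S

_⊨Inf_ : ∀ {n} → (ℕ → Fin n) → Subset n → Set
ρ ⊨Inf S = ¬ (ρ ⊨Fin S)

IsTransient : ∀ {n m} → Automaton n m → Subset n → Set
IsTransient 𝒜 S = ∀ ρ → IsRun 𝒜 ρ → ρ ⊨Inf (∁ S)

-- Once a run enters a trap set T it never leaves, so it is eventually always in T. Then it
-- visits every superset of T infinitely often, giving (i). For (ii), if the run visited S only
-- finitely often it would eventually stay in T ∖ S, i.e. visit the complement of T ∖ S only
-- finitely often, contradicting that T ∖ S is a transient.
module Submission where

open import Defs
open import Data.Nat using (ℕ; suc; s≤s; _≤_; _≤′_; ≤′-refl; ≤′-step; _⊔_)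
open import Data.Nat.Properties using (≤⇒≤′; <⇒≤; m⊔n<o⇒m<o; m⊔n<o⇒n<o; m≤m⊔n; m≤n⊔m)
open import Data.Fin using (Fin)
open import Data.Fin.Subset using (Subset; _∈_; _⊆_; _∩_; _─_; ∁; Nonempty)
open import Data.Fin.Subset.Properties using (x∈p⇒x∉∁p; x∈p∧x∉q⇒x∈p─q)
open import Data.Product using (∃; _×_; _,_)

private
  variable
    n m : ℕ
    ρ : ℕ → Fin n
    S T : Subset n

EventuallyIn : (ℕ → Fin n) → Subset n → Set
EventuallyIn ρ S = ∃ λ i → ∀ j → i ≤ j → ρ j ∈ S

EventuallyIn-mono : S ⊆ T → EventuallyIn ρ S → EventuallyIn ρ T
EventuallyIn-mono S⊆T (i , inS) = i , λ j i≤j → S⊆T (inS j i≤j)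

EventuallyIn⇒⊨Inf : EventuallyIn ρ S → ρ ⊨Inf S
EventuallyIn⇒⊨Inf (i , inS) (k , notInS) =
  notInS (suc (i ⊔ k)) (s≤s (m≤n⊔m i k)) (inS (suc (i ⊔ k)) (<⇒≤ (s≤s (m≤m⊔n i k))))

EventuallyIn⇒⊨Fin∁ : EventuallyIn ρ S → ρ ⊨Fin ∁ S
EventuallyIn⇒⊨Fin∁ (i , inS) = i , λ j i<j → x∈p⇒x∉∁p (inS j (<⇒≤ i<j))

EventuallyIn-─ : EventuallyIn ρ T → ρ ⊨Fin S → EventuallyIn ρ (T ─ S)
EventuallyIn-─ {T = T} (i , inT) (k , notInS) = suc (i ⊔ k) , λ j i⊔k<j →
  x∈p∧x∉q⇒x∈p─q {p = T} (inT j (<⇒≤ (m⊔n<o⇒m<o i k i⊔k<j))) (notInS j (m⊔n<o⇒n<o i k i⊔k<j))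

trap⇒EventuallyIn : (𝒜 : Automaton n m) → IsTrap 𝒜 T → IsRun 𝒜 ρ →
                    ∀ i → ρ i ∈ T → EventuallyIn ρ T
trap⇒EventuallyIn {T = T} {ρ = ρ} 𝒜 (_ , closed) (w , _ , step) i ρi∈T =
  i , λ j i≤j → stays (≤⇒≤′ i≤j)
  where
  stays : ∀ {j} → i ≤′ j → ρ j ∈ T
  stays ≤′-refl           = ρi∈T
  stays (≤′-step {j} i≤j) = closed (ρ j) (ρ (suc j)) (stays i≤j) (w j , step j)

theorem1 : ∀ {n m} (𝒜 : Automaton n m) (T : Subset n) → IsTrap 𝒜 T →
           (ρ : ℕ → Fin n) → IsRun 𝒜 ρ → (∃ λ i → ρ i ∈ T) →
           ((∀ S → T ⊆ S → ρ ⊨Inf S)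
           × (IsMinimalTrap 𝒜 T → ∀ S → Nonempty S → Nonempty (S ∩ T) →
                IsTransient 𝒜 (T ─ S) → ρ ⊨Inf S))
theorem1 𝒜 T trap ρ run (i , ρi∈T) =
    (λ S T⊆S → EventuallyIn⇒⊨Inf (EventuallyIn-mono T⊆S inT))
  , λ _ S _ _ transient finS →
      transient ρ run (EventuallyIn⇒⊨Fin∁ (EventuallyIn-─ inT finS))
  where
  inT : EventuallyIn ρ T
  inT = trap⇒EventuallyIn 𝒜 trap run i ρi∈T
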